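{- For every positive-Horn expression $\varphi\in\mathcal{H}^+$, the conjunctive normal form obtained from $\varphi$ by repeatedly applying distributivity (of $\bigvee$ over $\bigwedge$, flattening nested equal connectives) is a positive-Horn CNF, i.e. a conjunction of clauses each of which consists of exactly one positive element of $\mathcal{L}\cup\{\bot\}$ together with zero or more overlined elementary expressions.
   Context: Fix a set $\mathcal{A}$ of atoms; $\mathcal{L}=\mathcal{A}\cup\{\neg a:a\in\mathcal{A}\}$ (literals); for $\ell\in\mathcal{L}$, $\mathit{not}\,\ell$ is a default literal; elementary expressions are members of $\mathcal{E}^1=\mathcal{L}\cup\{\mathit{not}\,\ell:\ell\in\mathcal{L}\}\cup\{\top,\bot\}$; for each $x\in\mathcal{E}^1$, $\overline{x}$ is an overlined (negative) elementary expression. Expressions are built by $\bigwedge[\varphi_1\ldots\varphi_k]$ and $\bigvee(\varphi_1\ldots\varphi_k)$ from elementary and overlined elementary expressions. Positive elements are members of $\mathcal{L}\cup\{\bot\}$. $\mathcal{N}$ is the set of expressions in which every elementary occurrence is overlined. $\mathcal{H}^+$ is the smallest set such that: (1) $\mathcal{L}\cup\{\bot\}\subseteq\mathcal{H}^+$; (2) if $\varphi_1,\ldots,\varphi_k\in\mathcal{H}^+$ then $\bigwedge[\varphi_1\ldots\varphi_k]\in\mathcal{H}^+$; (3) if for some $i$, $\varphi_i\in\mathcal{H}^+$ and $\varphi_j\in\mathcal{N}$ for all $j\neq i$, then $\bigvee(\varphi_1\ldots\varphi_k)\in\mathcal{H}^+$. -}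

module Defs where

open import Data.List using (List; []; _∷_; _++_; concatMap; map)
open import Data.List.Relation.Unary.All using (All)
open import Data.List.Relation.Unary.Any using (Any)
open import Data.Product using (Σ; _×_; ∃-syntax)
open import Relation.Binary.PropositionalEquality using (_≡_)

module _ (Atom : Set) where

  data Lit : Set where
    pos : Atom → Lit
    neg : Atom → Lit

  data Elem : Set where
    lit  : Lit → Elem
    not′ : Lit → Elem         -- default literal  not ℓ
    ⊤e   : Elem
    ⊥e   : Elem

  data Expr : Set where
    el  : Elem → Expr
    ov  : Elem → Expr
    ⋀   : List Expr → Expr
    ⋁   : List Expr → Expr

  data IsPositive : Elem → Set where
    pos-lit : (l : Lit) → IsPositive (lit l)
    pos-⊥   : IsPositive ⊥e

  data InN : Expr → Set where
    n-ov : (x : Elem) → InN (ov x)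
    n-⋀  : {φs : List Expr} → All InN φs → InN (⋀ φs)
    n-⋁  : {φs : List Expr} → All InN φs → InN (⋁ φs)

  data InH+ : Expr → Set where
    h-pos : {x : Elem} → IsPositive x → InH+ (el x)
    h-⋀   : {φs : List Expr} → All InH+ φs → InH+ (⋀ φs)
    h-⋁   : (ψs : List Expr) (φ : Expr) (χs : List Expr) →
            All InN ψs → InH+ φ → All InN χs → InH+ (⋁ (ψs ++ φ ∷ χs))

  -- CNF: a conjunction (list) of clauses; a clause is a disjunction (list)
  -- of elementary or overlined elementary expressions.
  data CLit : Set where
    cel : Elem → CLit
    cov : Elem → CLit

  Clause : Set
  Clause = List CLit

  CNF : Set
  CNF = List Clause

  -- disjunction of two CNFs by distributivity: (⋀ cᵢ) ∨ (⋀ dⱼ) = ⋀_{i,j} (cᵢ ∨ dⱼ),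
  -- flattening nested disjunctions by concatenating clauses.
  _∨cnf_ : CNF → CNF → CNF
  cs ∨cnf ds = concatMap (λ c → map (c ++_) ds) cs

  mutual
    cnf : Expr → CNF
    cnf (el x)  = (cel x ∷ []) ∷ []
    cnf (ov x)  = (cov x ∷ []) ∷ []
    cnf (⋀ φs)  = cnfAnd φs
    cnf (⋁ φs)  = cnfOr φs

    cnfAnd : List Expr → CNF
    cnfAnd []       = []
    cnfAnd (φ ∷ φs) = cnf φ ++ cnfAnd φs

    cnfOr : List Expr → CNF
    cnfOr []       = [] ∷ []
    cnfOr (φ ∷ φs) = cnf φ ∨cnf cnfOr φs

  data IsOverlined : CLit → Set where
    is-ov : (x : Elem) → IsOverlined (cov x)

  PosHornClause : Clause → Set
  PosHornClause c =
    ∃[ xs ] ∃[ p ] ∃[ ys ]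
      (c ≡ xs ++ cel p ∷ ys) × IsPositive p × All IsOverlined xs × All IsOverlined ys

  PosHornCNF : CNF → Set
  PosHornCNF = All PosHornClause

{-# OPTIONS --safe #-}
-- Distributing ⋁ over ⋀ yields one clause per choice of a clause from every
-- disjunct, namely their union. Clauses of an expression in 𝒩 are entirely
-- overlined, and in a ℋ⁺ disjunction all disjuncts but one lie in 𝒩, so each
-- combined clause inherits exactly one positive element, from the distinguished
-- disjunct; ⋀ merely collects clauses.
module Submission where

open import Defs
open import Data.List using ([]; _∷_; _++_)
open import Data.List.Properties using (++-assoc)
open import Data.List.Relation.Unary.All as All using (All; []; _∷_)
open import Data.List.Relation.Unary.All.Properties using (++⁺; map⁺; concat⁺)
open import Data.Product using (_,_)
open import Relation.Binary.PropositionalEquality using (refl; sym)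

module _ {Atom : Set} where

  ∨cnf⁺ : ∀ {P Q R : Clause Atom → Set} {cs ds : CNF Atom} →
          (∀ {c d} → P c → Q d → R (c ++ d)) →
          All P cs → All Q ds → All R (_∨cnf_ Atom cs ds)
  ∨cnf⁺ combine ps qs = concat⁺ (map⁺ (All.map (λ p → map⁺ (All.map (combine p) qs)) ps))

  OverlinedClause : Clause Atom → Set
  OverlinedClause = All (IsOverlined Atom)

  posHorn-++ʳ : ∀ {c d} → PosHornClause Atom c → OverlinedClause d →
                PosHornClause Atom (c ++ d)
  posHorn-++ʳ {d = d} (xs , p , ys , refl , positive , ovxs , ovys) ovd =
    xs , p , ys ++ d , ++-assoc xs (cel p ∷ ys) d , positive , ovxs , ++⁺ ovys ovd

  posHorn-++ˡ : ∀ {c d} → OverlinedClause c → PosHornClause Atom d →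
                PosHornClause Atom (c ++ d)
  posHorn-++ˡ {c = c} ovc (xs , p , ys , refl , positive , ovxs , ovys) =
    c ++ xs , p , ys , sym (++-assoc c xs (cel p ∷ ys)) , positive , ++⁺ ovc ovxs , ovys

  mutual
    cnf-overlined : ∀ {φ} → InN Atom φ → All OverlinedClause (cnf Atom φ)
    cnf-overlined (n-ov x) = (is-ov x ∷ []) ∷ []
    cnf-overlined (n-⋀ ns) = cnfAnd-overlined ns
    cnf-overlined (n-⋁ ns) = cnfOr-overlined ns

    cnfAnd-overlined : ∀ {φs} → All (InN Atom) φs → All OverlinedClause (cnfAnd Atom φs)
    cnfAnd-overlined []       = []
    cnfAnd-overlined (n ∷ ns) = ++⁺ (cnf-overlined n) (cnfAnd-overlined ns)

    cnfOr-overlined : ∀ {φs} → All (InN Atom) φs → All OverlinedClause (cnfOr Atom φs)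
    cnfOr-overlined []       = [] ∷ []
    cnfOr-overlined (n ∷ ns) = ∨cnf⁺ ++⁺ (cnf-overlined n) (cnfOr-overlined ns)

  cnfOr-posHorn : ∀ {φ χs} ψs → All (InN Atom) ψs → PosHornCNF Atom (cnf Atom φ) →
                  All (InN Atom) χs → PosHornCNF Atom (cnfOr Atom (ψs ++ φ ∷ χs))
  cnfOr-posHorn []       []       hφ nχs = ∨cnf⁺ posHorn-++ʳ hφ (cnfOr-overlined nχs)
  cnfOr-posHorn (_ ∷ ψs) (n ∷ ns) hφ nχs =
    ∨cnf⁺ posHorn-++ˡ (cnf-overlined n) (cnfOr-posHorn ψs ns hφ nχs)

  mutual
    cnf-posHorn : ∀ {φ} → InH+ Atom φ → PosHornCNF Atom (cnf Atom φ)
    cnf-posHorn (h-pos {x} positive)   = ([] , x , [] , refl , positive , [] , []) ∷ []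
    cnf-posHorn (h-⋀ hs)               = cnfAnd-posHorn hs
    cnf-posHorn (h-⋁ ψs _ _ nψs h nχs) = cnfOr-posHorn ψs nψs (cnf-posHorn h) nχs

    cnfAnd-posHorn : ∀ {φs} → All (InH+ Atom) φs → PosHornCNF Atom (cnfAnd Atom φs)
    cnfAnd-posHorn []       = []
    cnfAnd-posHorn (h ∷ hs) = ++⁺ (cnf-posHorn h) (cnfAnd-posHorn hs)

proposition21 : (Atom : Set) (φ : Expr Atom) →
    InH+ Atom φ → PosHornCNF Atom (cnf Atom φ)
proposition21 _ _ = cnf-posHorn
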